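{- Let $(A,I,P)$ be an instance of the (single-layer) \textsc{Assignment} problem with $|A|=n$. Then for every Pareto optimal assignment $p$ and every agent $a\in A$, either $p(a)=b_\emptyset$ or $p(a)$ is one of the $n$ most preferred items in the preference list of $a$.
   Context: An instance $(A,I,P)$ of \textsc{Assignment} consists of a set $A$ of agents, a set $I$ of items, and a profile $P$ giving each agent $a$ a preference list $<_a$, a strict linear order over a subset of $I$ (the acceptable items of $a$). A special item $b_\emptyset\notin I$ is the least preferred item of every agent. An assignment is a map $p:A\to I\cup\{b_\emptyset\}$ assigning no item of $I$ to two different agents and assigning to each agent either $b_\emptyset$ or an item acceptable to it. An assignment $p$ is Pareto optimal if there is no other assignment $q$ with $p(a)\le_a q(a)$ for all $a\in A$ and $p(a)<_a q(a)$ for some $a$. -}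

module Defs where

open import Data.Nat using (ℕ; _<_)
open import Data.Fin using (Fin; toℕ)
open import Data.List using (List; length; lookup)
open import Data.List.Relation.Unary.Unique.Propositional using (Unique)
open import Data.List.Membership.Propositional using (_∈_)
open import Data.Maybe using (Maybe; just; nothing)
open import Data.Product using (Σ; ∃; _×_; _,_)
open import Data.Sum using (_⊎_)
open import Relation.Binary.PropositionalEquality using (_≡_; _≢_)
open import Relation.Nullary using (¬_)

-- Each agent's preference list is a duplicate-free list of items,
-- most preferred first (a strict linear order over the acceptable items).
record Instance (n m : ℕ) : Set where
  field
    pref   : Fin n → List (Fin m)
    unique : (a : Fin n) → Unique (pref a)

-- Items of I ∪ {b∅}: nothing represents b∅.
Item : ℕ → Set
Item m = Maybe (Fin m)

-- Strict preference x <_L y ("agent with list L strictly prefers y to x").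
-- b∅ is below every acceptable item; among items, earlier in the list is better.
data _<[_]_ {m : ℕ} : Item m → List (Fin m) → Item m → Set where
  empty<item : ∀ {L i} → i ∈ L → nothing <[ L ] just i
  item<item  : ∀ {L} (k l : Fin (length L)) → toℕ k < toℕ l →
               just (lookup L l) <[ L ] just (lookup L k)

_≤[_]_ : {m : ℕ} → Item m → List (Fin m) → Item m → Set
x ≤[ L ] y = x ≡ y ⊎ x <[ L ] y

record IsAssignment {n m : ℕ} (P : Instance n m) (p : Fin n → Item m) : Set where
  field
    acceptable : ∀ a i → p a ≡ just i → i ∈ Instance.pref P a
    injective  : ∀ a b i → p a ≡ just i → p b ≡ just i → a ≡ b

Dominates : {n m : ℕ} (P : Instance n m) (q p : Fin n → Item m) → Set
Dominates {n} {m} P q p =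
  ((a : Fin n) → p a ≤[ Instance.pref P a ] q a) ×
  ∃ λ a → p a <[ Instance.pref P a ] q a

ParetoOptimal : {n m : ℕ} (P : Instance n m) (p : Fin n → Item m) → Set
ParetoOptimal {n} {m} P p =
  IsAssignment P p ×
  ((q : Fin n → Item m) → IsAssignment P q → ¬ Dominates P q p)

AmongTop : {m : ℕ} → ℕ → List (Fin m) → Fin m → Set
AmongTop k L i = Σ (Fin (length L)) λ j → (toℕ j < k) × (lookup L j ≡ i)

module Submission where

-- Let p be Pareto optimal and suppose agent a holds the item at
-- position j of its preference list L, with j ≥ n.  Then each of the n
-- items at positions 0, …, n-1 of L is strictly better for a than p(a).
-- Such an item cannot be free: otherwise handing it to a (and changing
-- nothing else) is an assignment Pareto dominating p.  Nor can a hold it,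
-- since a holds the item at position j and L has no repetitions.  So the
-- n distinct top items are held by agents other than a, and since an
-- assignment gives distinct items to distinct agents this is an injection
-- of n items into the n - 1 other agents, contradicting the pigeonhole
-- principle.

open import Defs
open import Data.Nat using (ℕ; suc; _≤_; _<_; _<?_)
open import Data.Nat.Properties using (≤-trans; <-≤-trans; ≮⇒≥; <⇒≤; n<1+n)
open import Data.Fin using (Fin; toℕ; inject≤; punchOut; _≟_) renaming (zero to fzero; suc to fsuc)
open import Data.Fin.Properties using (toℕ<n; toℕ-inject≤; inject≤-injective; punchOut-injective; pigeonhole; any?; <⇒≢)
open import Data.Maybe using (just; nothing)
open import Data.Maybe.Properties using (just-injective) renaming (≡-dec to ≡-dec-Maybe)
open import Data.Sum using (_⊎_; inj₁; inj₂)
open import Data.Product using (∃; _×_; _,_; proj₁; proj₂)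
open import Data.List using (List; _∷_; length; lookup)
import Data.List.Relation.Unary.All as All
open import Data.List.Relation.Unary.AllPairs using (_∷_)
open import Data.List.Relation.Unary.Unique.Propositional using (Unique)
open import Data.List.Relation.Unary.Any using (index)
open import Data.List.Relation.Unary.Any.Properties using (lookup-index)
open import Data.List.Membership.Propositional using (_∈_)
open import Data.List.Membership.Propositional.Properties using (∈-lookup)
open import Data.Empty using (⊥; ⊥-elim)
open import Relation.Nullary using (yes; no)
open import Relation.Binary.PropositionalEquality using (_≡_; _≢_; refl; sym; trans; cong; subst)

lookup-injective : ∀ {A : Set} (L : List A) → Unique L →
  (j k : Fin (length L)) → lookup L j ≡ lookup L k → j ≡ k
lookup-injective (x ∷ L) u         fzero    fzero    _ = refl
lookup-injective (x ∷ L) (x∉ ∷ u)  fzero    (fsuc k) e = ⊥-elim (All.lookup x∉ (∈-lookup k) e)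
lookup-injective (x ∷ L) (x∉ ∷ u)  (fsuc j) fzero    e = ⊥-elim (All.lookup x∉ (∈-lookup j) (sym e))
lookup-injective (x ∷ L) (_  ∷ u)  (fsuc j) (fsuc k) e = cong fsuc (lookup-injective L u j k e)

-- Pigeonhole: a self-map of Fin (suc n) that misses some point a cannot be
-- injective, since it really maps into the n remaining points.
no-injection-avoiding : ∀ {n} (a : Fin (suc n)) (f : Fin (suc n) → Fin (suc n)) →
  (∀ k → a ≢ f k) → (∀ k l → f k ≡ f l → k ≡ l) → ⊥
no-injection-avoiding {n} a f avoids injective
  with pigeonhole (n<1+n n) (λ k → punchOut (avoids k))
... | k , l , k<l , same = <⇒≢ k<l (injective k l (punchOut-injective (avoids k) (avoids l) same))

better-is-acceptable : ∀ {m} {L : List (Fin m)} {x i} → x <[ L ] just i → i ∈ L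
better-is-acceptable (empty<item i∈L)  = i∈L
better-is-acceptable (item<item k _ _) = ∈-lookup k

reassign : ∀ {n m} → (Fin n → Item m) → Fin n → Fin m → Fin n → Item m
reassign p a i b with b ≟ a
... | yes _ = just i
... | no _  = p b

reassign-isAssignment : ∀ {n m} (P : Instance n m) (p : Fin n → Item m) (a : Fin n) (i : Fin m) →
  IsAssignment P p → i ∈ Instance.pref P a → (∀ b → p b ≢ just i) →
  IsAssignment P (reassign p a i)
IsAssignment.acceptable (reassign-isAssignment P p a i isA i∈ free) b i′ e with b ≟ a
... | yes refl = subst (_∈ Instance.pref P a) (just-injective e) i∈
... | no _     = IsAssignment.acceptable isA b i′ e
IsAssignment.injective (reassign-isAssignment P p a i isA i∈ free) b c i′ e₁ e₂ with b ≟ a | c ≟ a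
... | yes b≡a | yes c≡a = trans b≡a (sym c≡a)
... | yes _   | no _    = ⊥-elim (free c (trans e₂ (sym e₁)))
... | no _    | yes _   = ⊥-elim (free b (trans e₁ (sym e₂)))
... | no _    | no _    = IsAssignment.injective isA b c i′ e₁ e₂

reassign-dominates : ∀ {n m} (P : Instance n m) (p : Fin n → Item m) (a : Fin n) (i : Fin m) →
  p a <[ Instance.pref P a ] just i → Dominates P (reassign p a i) p
reassign-dominates P p a i better = weakly , a , strictly
  where
  strictly : p a <[ Instance.pref P a ] reassign p a i a
  strictly with a ≟ a
  ... | yes _   = better
  ... | no a≢a  = ⊥-elim (a≢a refl)
  weakly : ∀ b → p b ≤[ Instance.pref P b ] reassign p a i b
  weakly b with b ≟ a
  ... | yes refl = inj₂ better
  ... | no _     = inj₁ refl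

better-items-are-held : ∀ {n m} (P : Instance n m) (p : Fin n → Item m) →
  ParetoOptimal P p → (a : Fin n) (i : Fin m) →
  p a <[ Instance.pref P a ] just i → ∃ λ b → p b ≡ just i
better-items-are-held P p (isA , optimal) a i better
  with any? (λ b → ≡-dec-Maybe _≟_ (p b) (just i))
... | yes held = held
... | no ¬held = ⊥-elim (optimal (reassign p a i)
        (reassign-isAssignment P p a i isA (better-is-acceptable better) (λ b e → ¬held (b , e)))
        (reassign-dominates P p a i better))

rank-bound : ∀ {n m} (P : Instance (suc n) m) (p : Fin (suc n) → Item m) →
  ParetoOptimal P p → (a : Fin (suc n)) (j : Fin (length (Instance.pref P a))) →
  p a ≡ just (lookup (Instance.pref P a) j) → toℕ j < suc n
rank-bound {n} {m} P p po a j pa≡ with toℕ j <? suc n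
... | yes j<n = j<n
... | no j≮n  = ⊥-elim (no-injection-avoiding a holder a-holds-none holder-injective)
  where
  L : List (Fin m)
  L = Instance.pref P a
  n≤len : suc n ≤ length L
  n≤len = ≤-trans (≮⇒≥ j≮n) (<⇒≤ (toℕ<n j))
  top : Fin (suc n) → Fin (length L)
  top k = inject≤ k n≤len
  top<j : ∀ k → toℕ (top k) < toℕ j
  top<j k = subst (_< toℕ j) (sym (toℕ-inject≤ k n≤len)) (<-≤-trans (toℕ<n k) (≮⇒≥ j≮n))
  top-better : ∀ k → p a <[ L ] just (lookup L (top k))
  top-better k = subst (_<[ L ] just (lookup L (top k))) (sym pa≡) (item<item (top k) j (top<j k))
  held : ∀ k → ∃ λ b → p b ≡ just (lookup L (top k))
  held k = better-items-are-held P p po a (lookup L (top k)) (top-better k)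
  holder : Fin (suc n) → Fin (suc n)
  holder k = proj₁ (held k)
  -- holders of different top items differ, since p is a function
  holder-injective : ∀ k l → holder k ≡ holder l → k ≡ l
  holder-injective k l same = inject≤-injective n≤len n≤len k l
    (lookup-injective L (Instance.unique P a) (top k) (top l)
      (just-injective (trans (sym (proj₂ (held k))) (trans (cong p same) (proj₂ (held l))))))
  -- a holds the item at position j, which is not among the top ones
  a-holds-none : ∀ k → a ≢ holder k
  a-holds-none k a≡holder = <⇒≢ (top<j k)
    (lookup-injective L (Instance.unique P a) (top k) j
      (just-injective (trans (sym (proj₂ (held k))) (trans (cong p (sym a≡holder)) pa≡))))

lemma2 : (n m : ℕ) (P : Instance n m) (p : Fin n → Item m) →
    ParetoOptimal P p → (a : Fin n) →
    (p a ≡ nothing) ⊎ (∃ λ i → p a ≡ just i × AmongTop n (Instance.pref P a) i)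
lemma2 (suc n) m P p po a with p a in pa≡
... | nothing = inj₁ refl
... | just i  = inj₂ (i , refl , j , rank-bound P p po a j pa≡j , sym i≡Lj)
  where
  i∈L : i ∈ Instance.pref P a
  i∈L = IsAssignment.acceptable (proj₁ po) a i pa≡
  j : Fin (length (Instance.pref P a))
  j = index i∈L
  i≡Lj : i ≡ lookup (Instance.pref P a) j
  i≡Lj = lookup-index i∈L
  pa≡j : p a ≡ just (lookup (Instance.pref P a) j)
  pa≡j = trans pa≡ (cong just i≡Lj)
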